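{- Let $G$ be a cograph. Then the independence-domination number $\gamma^i(G)$ equals the number of connected components of $G$.
   Context: All graphs are finite and simple. A cograph is a graph with no induced $P_4$. For a set $B$ of vertices of $G$, $\gamma_G(B)$ is the minimum cardinality of a set $A \subseteq V(G)$ such that $B \subseteq \bigcup_{x\in A} N[x]$ ($N[x]$ the closed neighborhood). The independence-domination number is $\gamma^i(G) = \max\{\gamma_G(A) : A \text{ an independent set of } G\}$. -}

module Defs where

open import Data.Nat using (ℕ; zero; suc; _≤_)
open import Data.Bool using (Bool; true; false)
open import Data.Fin using (Fin)
open import Data.Fin.Subset using (Subset; _∈_; ∣_∣)
open import Data.Product using (Σ; _×_; _,_; ∃)
open import Data.Sum using (_⊎_)
open import Relation.Binary.PropositionalEquality using (_≡_; _≢_)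
open import Relation.Nullary using (¬_)

record Graph (n : ℕ) : Set where
  field
    adj   : Fin n → Fin n → Bool
    sym   : ∀ x y → adj x y ≡ adj y x
    irrefl : ∀ x → adj x x ≡ false

open Graph public

Adj : ∀ {n} → Graph n → Fin n → Fin n → Set
Adj G x y = adj G x y ≡ true

InClosedNbhd : ∀ {n} → Graph n → Fin n → Fin n → Set
InClosedNbhd G x y = (x ≡ y) ⊎ Adj G x y

InducedP4 : ∀ {n} → Graph n → Fin n → Fin n → Fin n → Fin n → Set
InducedP4 G a b c d =
  Adj G a b × Adj G b c × Adj G c d ×
  ¬ Adj G a c × ¬ Adj G a d × ¬ Adj G b d

-- Cograph: no induced P4 (distinctness is implied by the (non)adjacencies
-- and irreflexivity).
IsCograph : ∀ {n} → Graph n → Set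
IsCograph G = ∀ a b c d → ¬ InducedP4 G a b c d

Independent : ∀ {n} → Graph n → Subset n → Set
Independent G B = ∀ x y → x ∈ B → y ∈ B → ¬ Adj G x y

Dominates : ∀ {n} → Graph n → Subset n → Subset n → Set
Dominates G A B = ∀ y → y ∈ B → ∃ λ x → x ∈ A × InClosedNbhd G x y

DomNumber : ∀ {n} → Graph n → Subset n → ℕ → Set
DomNumber G B k =
  (∃ λ A → Dominates G A B × ∣ A ∣ ≡ k) ×
  (∀ A → Dominates G A B → k ≤ ∣ A ∣)

IndDomNumber : ∀ {n} → Graph n → ℕ → Set
IndDomNumber G k =
  (∃ λ B → Independent G B × DomNumber G B k) ×
  (∀ B m → Independent G B → DomNumber G B m → m ≤ k)

data Connected {n} (G : Graph n) : Fin n → Fin n → Set where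
  here : ∀ {x} → Connected G x x
  step : ∀ {x y z} → Adj G x y → Connected G y z → Connected G x z

NumComponents : ∀ {n} → Graph n → ℕ → Set
NumComponents G c =
  ∃ λ (R : Subset _) →
    ∣ R ∣ ≡ c ×
    (∀ x y → x ∈ R → y ∈ R → Connected G x y → x ≡ y) ×
    (∀ v → ∃ λ r → r ∈ R × Connected G v r)

-- A set of vertices pairwise in different components must be dominated by at
-- least that many vertices, since a vertex only dominates within its own
-- component; the component representatives form such an independent set.
-- Conversely, in a cograph any two connected vertices are at distance at most
-- two, and this lets one vertex dominate all of an independent set lying in a
-- single component: if v dominates the earlier vertices and b' is a new one
-- outside N[v], a common neighbour w of v and b' dominates everything, for a
-- neighbour b of v missed by w would give the induced path b – v – w – b'.
module Submission where

open import Defs hiding (sym)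
open import Data.Nat using (ℕ; suc; _≤_; z≤n; s≤s)
open import Data.Nat.Properties using (≤-trans; module ≤-Reasoning)
open import Data.Bool using (true)
import Data.Bool.Properties as Bool
open import Data.Fin using (Fin; _≟_)
open import Data.Fin.Properties using (suc-injective; 0≢1+n; any?)
open import Data.Fin.Subset using (Subset; _∈_; ∣_∣; inside; outside; _-_)
open import Data.Fin.Subset.Properties using (_∈?_; x∈p⇒∣p-x∣<∣p∣; x∈p∧x≢y⇒x∈p-y)
open import Data.Vec using ([]; _∷_; tabulate; here; there)
open import Data.Vec.Properties using (lookup⇒[]=; []=⇒lookup; lookup∘tabulate)
open import Data.List using (List; []; _∷_; allFin)
open import Data.List.Relation.Unary.All as All using (All; []; _∷_)
open import Data.List.Membership.Propositional.Properties using (∈-allFin)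
open import Data.Product using (_×_; _,_; ∃; proj₁; proj₂)
open import Data.Sum using (inj₁; inj₂)
open import Data.Empty using (⊥-elim)
open import Function using (_∘_)
open import Relation.Nullary using (¬_; yes; no; does)
open import Relation.Nullary.Decidable using (dec-true; map′; _×-dec_; _⊎-dec_)
open import Relation.Binary using (Decidable)
open import Relation.Binary.PropositionalEquality using (_≡_; refl; sym; trans; cong; subst)

injection⇒∣p∣≤∣q∣ : ∀ {n m} {p : Subset n} {q : Subset m}
  (f : ∀ {x} → x ∈ p → Fin m) →
  (∀ {x} (x∈p : x ∈ p) → f x∈p ∈ q) →
  (∀ {x y} (x∈p : x ∈ p) (y∈p : y ∈ p) → f x∈p ≡ f y∈p → x ≡ y) →
  ∣ p ∣ ≤ ∣ q ∣
injection⇒∣p∣≤∣q∣ {p = []} f f∈q f-inj = z≤n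
injection⇒∣p∣≤∣q∣ {p = outside ∷ p} f f∈q f-inj =
  injection⇒∣p∣≤∣q∣ (λ x∈p → f (there x∈p)) (λ x∈p → f∈q (there x∈p))
    (λ x∈p y∈p eq → suc-injective (f-inj (there x∈p) (there y∈p) eq))
injection⇒∣p∣≤∣q∣ {p = inside ∷ p} {q} f f∈q f-inj = begin
  suc ∣ p ∣          ≤⟨ s≤s (injection⇒∣p∣≤∣q∣ (λ x∈p → f (there x∈p)) f∈q-f₀ f-inj′) ⟩
  suc ∣ q - f here ∣  ≤⟨ x∈p⇒∣p-x∣<∣p∣ (f∈q here) ⟩
  ∣ q ∣              ∎
  where
  open ≤-Reasoning
  f∈q-f₀ : ∀ {x} (x∈p : x ∈ p) → f (there x∈p) ∈ q - f here
  f∈q-f₀ x∈p = x∈p∧x≢y⇒x∈p-y (f∈q (there x∈p))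
    (λ eq → 0≢1+n (sym (f-inj (there x∈p) here eq)))
  f-inj′ : ∀ {x y} (x∈p : x ∈ p) (y∈p : y ∈ p) →
    f (there x∈p) ≡ f (there y∈p) → x ≡ y
  f-inj′ x∈p y∈p eq = suc-injective (f-inj (there x∈p) (there y∈p) eq)

image : ∀ {n m} → (Fin n → Fin m) → Subset n → Subset m
image f p = tabulate λ y → does (any? λ x → x ∈? p ×-dec f x ≟ y)

module _ {n m} (f : Fin n → Fin m) (p : Subset n) where

  ∈-image⁺ : ∀ {x} → x ∈ p → f x ∈ image f p
  ∈-image⁺ {x} x∈p = lookup⇒[]= (f x) (image f p)
    (trans (lookup∘tabulate _ (f x)) (dec-true (any? _) (x , x∈p , refl)))

  ∈-image⁻ : ∀ {y} → y ∈ image f p → ∃ λ x → x ∈ p × f x ≡ y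
  ∈-image⁻ {y} y∈fp
    with any? (λ x → x ∈? p ×-dec f x ≟ y)
       | trans (sym (lookup∘tabulate _ y)) ([]=⇒lookup y∈fp)
  ... | yes preimage | _ = preimage
  ... | no _         | ()

∣image∣≤∣p∣ : ∀ {n m} (f : Fin n → Fin m) (p : Subset n) → ∣ image f p ∣ ≤ ∣ p ∣
∣image∣≤∣p∣ {n} f p = injection⇒∣p∣≤∣q∣ preimage (λ y∈fp → proj₁ (proj₂ (∈-image⁻ f p y∈fp)))
  (λ y∈fp y′∈fp eq → trans (sym (f-preimage y∈fp)) (trans (cong f eq) (f-preimage y′∈fp)))
  where
  preimage : ∀ {y} → y ∈ image f p → Fin n
  preimage y∈fp = proj₁ (∈-image⁻ f p y∈fp)
  f-preimage : ∀ {y} (y∈fp : y ∈ image f p) → f (preimage y∈fp) ≡ y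
  f-preimage y∈fp = proj₂ (proj₂ (∈-image⁻ f p y∈fp))

PairwiseDisconnected : ∀ {n} → Graph n → Subset n → Set
PairwiseDisconnected G S = ∀ x y → x ∈ S → y ∈ S → Connected G x y → x ≡ y

MeetsEveryComponent : ∀ {n} → Graph n → Subset n → Set
MeetsEveryComponent G R = ∀ v → ∃ λ r → r ∈ R × Connected G v r

module _ {n} (G : Graph n) where

  Adj-sym : ∀ {x y} → Adj G x y → Adj G y x
  Adj-sym {x} {y} x~y = trans (Graph.sym G y x) x~y

  adj? : Decidable (Adj G)
  adj? x y = adj G x y Bool.≟ true

  closedNbhd? : Decidable (InClosedNbhd G)
  closedNbhd? x y = x ≟ y ⊎-dec adj? x y

  connected-snoc : ∀ {x y z} → Connected G x y → Adj G y z → Connected G x z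
  connected-snoc here       y~z = step y~z here
  connected-snoc (step a c) y~z = step a (connected-snoc c y~z)

  connected-trans : ∀ {x y z} → Connected G x y → Connected G y z → Connected G x z
  connected-trans here       d = d
  connected-trans (step a c) d = step a (connected-trans c d)

  connected-sym : ∀ {x y} → Connected G x y → Connected G y x
  connected-sym here       = here
  connected-sym (step a c) = connected-snoc (connected-sym c) (Adj-sym a)

  closedNbhd⇒connected : ∀ {x y} → InClosedNbhd G x y → Connected G x y
  closedNbhd⇒connected (inj₁ refl) = here
  closedNbhd⇒connected (inj₂ x~y)  = step x~y here

  pairwiseDisconnected⇒independent : ∀ {S} → PairwiseDisconnected G S → Independent G S
  pairwiseDisconnected⇒independent disc x y x∈S y∈S x~y
    with refl ← disc x y x∈S y∈S (step x~y here)
    with () ← trans (sym x~y) (irrefl G x)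

  pairwiseDisconnected⇒DomNumber : ∀ {S} → PairwiseDisconnected G S → DomNumber G S ∣ S ∣
  pairwiseDisconnected⇒DomNumber {S} disc =
    (S , (λ y y∈S → y , y∈S , inj₁ refl) , refl) ,
    λ A dom → injection⇒∣p∣≤∣q∣ (dominator dom) (λ x∈S → proj₁ (proj₂ (dom _ x∈S)))
      (λ {x} {y} x∈S y∈S eq → disc x y x∈S y∈S
        (connected-trans (connected-sym (dominator-connected dom x∈S))
          (subst (λ d → Connected G d y) (sym eq) (dominator-connected dom y∈S))))
    where
    dominator : ∀ {A x} → Dominates G A S → x ∈ S → Fin n
    dominator {x = x} dom x∈S = proj₁ (dom x x∈S)
    dominator-connected : ∀ {A x} (dom : Dominates G A S) (x∈S : x ∈ S) →
      Connected G (dominator dom x∈S) x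
    dominator-connected {x = x} dom x∈S = closedNbhd⇒connected (proj₂ (proj₂ (dom x x∈S)))

  Distance≤2 : Fin n → Fin n → Set
  Distance≤2 u z = ∃ λ w → InClosedNbhd G u w × InClosedNbhd G w z

  distance≤2? : Decidable Distance≤2
  distance≤2? u z = any? λ w → closedNbhd? u w ×-dec closedNbhd? w z

  distance≤2⇒connected : ∀ {u z} → Distance≤2 u z → Connected G u z
  distance≤2⇒connected (w , u-w , w-z) =
    connected-trans (closedNbhd⇒connected u-w) (closedNbhd⇒connected w-z)

  module _ (cograph : IsCograph G) where

    p4-chord : ∀ {a b c d} → Adj G a b → Adj G b c → Adj G c d →
      ¬ Adj G a d → ¬ Adj G b d → Adj G a c
    p4-chord {a} {b} {c} {d} a~b b~c c~d a≁d b≁d with adj? a c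
    ... | yes a~c = a~c
    ... | no  a≁c = ⊥-elim (cograph a b c d (a~b , b~c , c~d , a≁c , a≁d , b≁d))

    distance≤2-extend : ∀ {u z z′} → Distance≤2 u z → Adj G z z′ → Distance≤2 u z′
    distance≤2-extend (w , u-w , inj₁ refl) z~z′ = w , u-w , inj₂ z~z′
    distance≤2-extend (w , inj₁ refl , inj₂ w~z) z~z′ = _ , inj₂ w~z , inj₂ z~z′
    distance≤2-extend {u} {z} {z′} (w , inj₂ u~w , inj₂ w~z) z~z′
      with closedNbhd? w z′ | closedNbhd? u z′
    ... | yes w-z′ | _        = w , inj₂ u~w , w-z′
    ... | no  _    | yes u-z′ = u , inj₁ refl , u-z′
    ... | no  z′∉N[w] | no  z′∉N[u] =
      z , inj₂ (p4-chord u~w w~z z~z′ (z′∉N[u] ∘ inj₂) (z′∉N[w] ∘ inj₂)) , inj₂ z~z′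

    connected⇒distance≤2 : ∀ {u z} → Connected G u z → Distance≤2 u z
    connected⇒distance≤2 {u} = go (u , inj₁ refl , inj₁ refl)
      where
      go : ∀ {y z} → Distance≤2 u y → Connected G y z → Distance≤2 u z
      go d here       = d
      go d (step a c) = go (distance≤2-extend d a) c

    connected? : Decidable (Connected G)
    connected? u z = map′ distance≤2⇒connected connected⇒distance≤2 (distance≤2? u z)

    commonNeighbour : ∀ {u z} → Connected G u z → ¬ InClosedNbhd G u z →
      ∃ λ w → Adj G u w × Adj G w z
    commonNeighbour c z∉N[u] with connected⇒distance≤2 c
    ... | w , inj₁ refl , w-z       = ⊥-elim (z∉N[u] w-z)
    ... | w , inj₂ u~w  , inj₁ refl = ⊥-elim (z∉N[u] (inj₂ u~w))
    ... | w , inj₂ u~w  , inj₂ w~z  = w , u~w , w~z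

    module _ {B : Subset n} (independent : Independent G B) (r : Fin n) where

      DominatesInComponent : Fin n → Fin n → Set
      DominatesInComponent v b = b ∈ B → Connected G b r → InClosedNbhd G v b

      dominatorOfList : (xs : List (Fin n)) →
        ∃ λ v → Connected G v r × All (DominatesInComponent v) xs
      dominatorOfList [] = r , here , []
      dominatorOfList (b′ ∷ xs) with dominatorOfList xs
      ... | v , v⇝r , dom with b′ ∈? B ×-dec connected? b′ r
      ... | no b′-irrelevant = v , v⇝r , (λ b′∈B b′⇝r → ⊥-elim (b′-irrelevant (b′∈B , b′⇝r))) ∷ dom
      ... | yes (b′∈B , b′⇝r) with closedNbhd? v b′
      ...   | yes v-b′ = v , v⇝r , (λ _ _ → v-b′) ∷ dom
      ...   | no b′∉N[v]
              with commonNeighbour (connected-trans v⇝r (connected-sym b′⇝r)) b′∉N[v]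
      ...     | w , v~w , w~b′ =
                w , step w~b′ b′⇝r , (λ _ _ → inj₂ w~b′) ∷ All.map shift dom
        where
        shift : ∀ {b} → DominatesInComponent v b → DominatesInComponent w b
        shift {b} dom-b b∈B b⇝r with dom-b b∈B b⇝r
        ... | inj₁ refl = inj₂ (Adj-sym v~w)
        ... | inj₂ v~b  = inj₂ (Adj-sym (p4-chord (Adj-sym v~b) v~w w~b′
                            (independent b b′ b∈B b′∈B) (b′∉N[v] ∘ inj₂)))

      componentDominator : ∃ λ v → Connected G v r × (∀ b → DominatesInComponent v b)
      componentDominator =
        let v , v⇝r , dom = dominatorOfList (allFin n)
        in  v , v⇝r , λ b → All.lookup dom (∈-allFin b)

    independent⇒smallDominatingSet : ∀ {B R} → Independent G B → MeetsEveryComponent G R →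
      ∃ λ A → Dominates G A B × ∣ A ∣ ≤ ∣ R ∣
    independent⇒smallDominatingSet {B} {R} independent meets =
      image dominator R , dominates , ∣image∣≤∣p∣ dominator R
      where
      dominator : Fin n → Fin n
      dominator r = proj₁ (componentDominator independent r)

      dominates : Dominates G (image dominator R) B
      dominates y y∈B =
        let r , r∈R , y⇝r = meets y
            _ , _ , dom = componentDominator independent r
        in  dominator r , ∈-image⁺ dominator R r∈R , dom y y∈B y⇝r

mainTheorem2 : ∀ (n : ℕ) (G : Graph n) (c : ℕ) → IsCograph G →
    NumComponents G c → IndDomNumber G c
mainTheorem2 n G c cograph (R , ∣R∣≡c , disconnected , meets) =
  (R , pairwiseDisconnected⇒independent G disconnected ,
       subst (DomNumber G R) ∣R∣≡c (pairwiseDisconnected⇒DomNumber G disconnected)) ,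
  λ B m independent (_ , minimal) →
    let A , A-dominates , ∣A∣≤∣R∣ = independent⇒smallDominatingSet G cograph independent meets
    in  ≤-trans (minimal A A-dominates) (subst (∣ A ∣ ≤_) ∣R∣≡c ∣A∣≤∣R∣)
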